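{- There exists a skew Hadamard matrix of order $4\cdot 397 = 1588$, i.e. a $1588\times 1588$ matrix $M$ with entries in $\{1,-1\}$ such that $MM^{T}=1588\, I$ and $M+M^{T}=2I$. -}

module Defs where

open import Data.Nat using (ℕ)
open import Data.Fin using (Fin)
open import Data.Integer using (ℤ; +_; -[1+_]; _+_; _*_; 0ℤ)
open import Data.Vec.Functional using (foldr)
open import Relation.Binary.PropositionalEquality using (_≡_)
open import Data.Sum using (_⊎_)
open import Data.Product using (_×_)
open import Relation.Nullary using (¬_)

Matrix : ℕ → Set
Matrix n = Fin n → Fin n → ℤ

∑ : ∀ {n} → (Fin n → ℤ) → ℤ
∑ = foldr _+_ 0ℤ

_*ᵀ : ∀ {n} → Matrix n → Matrix n
(M *ᵀ) i j = ∑ (λ k → M i k * M j k)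

scalarI : ∀ {n} → ℤ → Matrix n
scalarI c i j with i Data.Fin.≟ j
... | Relation.Nullary.yes _ = c
... | Relation.Nullary.no  _ = 0ℤ

PlusMinusOne : ℤ → Set
PlusMinusOne x = (x ≡ + 1) ⊎ (x ≡ -[1+ 0 ])

IsSkewHadamard : (n : ℕ) → Matrix n → Set
IsSkewHadamard n M =
  (∀ i j → PlusMinusOne (M i j)) ×
  (∀ i j → (M *ᵀ) i j ≡ scalarI (+ n) i j) ×
  (∀ i j → M i j + M j i ≡ scalarI (+ 2) i j)

{-# OPTIONS --safe #-}
module Submission where

-- The Goethals–Seidel array turns four circulant ±1 matrices A, B, C, D of order n with
-- AAᵀ + BBᵀ + CCᵀ + DDᵀ = 4nI into a Hadamard matrix of order 4n, which is skew when
-- A + Aᵀ = 2I.  Each block of the array has entries ±s(εy + ηx) for one of the four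
-- defining sequences s and signs ε, η, so the inner product of two rows of the array is a
-- sum of periodic correlations of these sequences.  For rows in different block rows the
-- terms cancel in pairs, because swapping the two sequences of a correlation only
-- reflects the lag; for rows in the same block row they add up to the total periodic
-- autocorrelation, which is 4n at lag 0 and vanishes at every other lag.  For n = 397,
-- four such sequences are listed explicitly and their properties are checked by evaluation.

open import Algebra.Properties.CommutativeMonoid.Sum as Sum using ()
open import Data.Bool.Base using (if_then_else_)
open import Data.Fin.Base as Fin using (Fin; zero; suc; toℕ; combine; remQuot; _↑ˡ_; _↑ʳ_)
open import Data.Fin.Patterns using (0F; 1F; 2F; 3F)
import Data.Fin.Permutation as Perm
open import Data.Fin.Properties as Fin
  using (all?; toℕ<n; toℕ-injective; toℕ-inject₁; toℕ-fromℕ; toℕ-fromℕ<; opposite-prop;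
         remQuot-combine; combine-remQuot; combine-injectiveˡ; combine-injectiveʳ)
open import Data.Integer.Base as ℤ using (ℤ; +_; -[1+_]; -_; _+_; _-_; _*_; 0ℤ; 1ℤ)
import Data.Integer.Properties as ℤ
open import Data.Integer.Solver using (module +-*-Solver)
open import Data.List.Base as List using (List; []; _∷_)
open import Data.Nat.Base as ℕ using (ℕ; zero; suc)
import Data.Nat.DivMod as ℕ
import Data.Nat.Properties as ℕ
open import Data.Product.Base using (∃; _×_; _,_; proj₁; proj₂)
open import Data.Sign.Base as Sign using (Sign; opposite)
import Data.Sign.Properties as Sign
open import Data.String using (String; toList; fromChar; _==_)
open import Data.Sum.Base using (inj₁; inj₂)
open import Data.Vec.Base as Vec using (Vec; []; _∷_)
open import Function.Base using (_∘_)
open import Relation.Binary.Definitions using (Tri; tri<; tri≈; tri>)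
open import Relation.Binary.PropositionalEquality
open import Relation.Nullary.Decidable using (Dec; yes; no; ¬?; _×-dec_; _→-dec_; from-yes)
open import Relation.Nullary.Negation using (contradiction)
open import Defs

open Sum ℤ.+-0-commutativeMonoid using (sum-cong-≗; sum-init-last; ∑-permute)
open +-*-Solver using (solve; _:+_; _:*_; _:-_; :-_; _:=_)
open ≡-Reasoning

∑-cong : ∀ {n} {f g : Fin n → ℤ} → (∀ i → f i ≡ g i) → ∑ f ≡ ∑ g
∑-cong = sum-cong-≗

∑-++ : ∀ m {n} (f : Fin (m ℕ.+ n) → ℤ) → ∑ f ≡ ∑ (λ i → f (i ↑ˡ n)) + ∑ (λ j → f (m ↑ʳ j))
∑-++ zero    f = sym (ℤ.+-identityˡ _)
∑-++ (suc m) f = trans (cong (_+_ (f zero)) (∑-++ m (f ∘ suc))) (sym (ℤ.+-assoc (f zero) _ _))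

∑-combine : ∀ m {n} (f : Fin (m ℕ.* n) → ℤ) →
            ∑ f ≡ ∑ (λ (a : Fin m) → ∑ (λ (x : Fin n) → f (combine a x)))
∑-combine zero        f = refl
∑-combine (suc m) {n} f =
  trans (∑-++ n f) (cong (_+_ (∑ (λ x → f (x ↑ˡ m ℕ.* n)))) (∑-combine m (f ∘ (n ↑ʳ_))))

∑-negate : ∀ {n} (f : Fin n → ℤ) → ∑ (λ i → - f i) ≡ - ∑ f
∑-negate {zero}  f = refl
∑-negate {suc n} f =
  trans (cong (_+_ (- f zero)) (∑-negate (f ∘ suc))) (sym (ℤ.neg-distrib-+ (f zero) _))

∑-const-1 : ∀ n → ∑ {n} (λ _ → 1ℤ) ≡ + n
∑-const-1 zero    = refl
∑-const-1 (suc n) = cong (_+_ 1ℤ) (∑-const-1 n)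

∑-involution : ∀ {n} (π : Fin n → Fin n) → (∀ i → π (π i) ≡ i) →
               (f : Fin n → ℤ) → ∑ (f ∘ π) ≡ ∑ f
∑-involution π π-involutive f =
  sym (∑-permute f (Perm.permutation π π π-involutive π-involutive))

x≡-x⇒x≡0 : ∀ {x} → x ≡ - x → x ≡ 0ℤ
x≡-x⇒x≡0 {+ zero} _ = refl

signReversingInvolution⇒∑≡0 : ∀ {n} (π : Fin n → Fin n) → (∀ i → π (π i) ≡ i) →
                               (f : Fin n → ℤ) → (∀ i → f (π i) ≡ - f i) → ∑ f ≡ 0ℤ
signReversingInvolution⇒∑≡0 π π-involutive f f∘π≡-f = x≡-x⇒x≡0 (begin
  ∑ f         ≡⟨ ∑-involution π π-involutive f ⟨
  ∑ (f ∘ π)   ≡⟨ ∑-cong f∘π≡-f ⟩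
  ∑ (-_ ∘ f)  ≡⟨ ∑-negate f ⟩
  - ∑ f       ∎)

infixr 8 _·_
_·_ : Sign → ℤ → ℤ
Sign.+ · z = z
Sign.- · z = - z

·-±1 : ∀ s {z} → PlusMinusOne z → PlusMinusOne (s · z)
·-±1 Sign.+ z≡±1        = z≡±1
·-±1 Sign.- (inj₁ refl) = inj₂ refl
·-±1 Sign.- (inj₂ refl) = inj₁ refl

±1*±1≡1 : ∀ {x} → PlusMinusOne x → x * x ≡ 1ℤ
±1*±1≡1 (inj₁ refl) = refl
±1*±1≡1 (inj₂ refl) = refl

opposite-· : ∀ s z → opposite s · z ≡ - (s · z)
opposite-· Sign.+ z = refl
opposite-· Sign.- z = sym (ℤ.neg-involutive z)

*-· : ∀ s t z → (s Sign.* t) · z ≡ s · (t · z)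
*-· Sign.+ t      z = refl
*-· Sign.- Sign.+ z = refl
*-· Sign.- Sign.- z = sym (ℤ.neg-involutive z)

·-*-· : ∀ s t a b → (s · a) * (t · b) ≡ (s Sign.* t) · (a * b)
·-*-· Sign.+ Sign.+ a b = refl
·-*-· Sign.+ Sign.- a b = sym (ℤ.neg-distribʳ-* a b)
·-*-· Sign.- Sign.+ a b = sym (ℤ.neg-distribˡ-* a b)
·-*-· Sign.- Sign.- a b = solve 2 (λ a b → (:- a) :* (:- b) := a :* b) refl a b

∑-· : ∀ {n} s (f : Fin n → ℤ) → ∑ (λ i → s · f i) ≡ s · ∑ f
∑-· Sign.+ f = refl
∑-· Sign.- f = ∑-negate f

Periodic : ℕ → (ℤ → ℤ) → Set
Periodic n f = ∀ z → f (z + + n) ≡ f z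

periodic-affine : ∀ {n f} → Periodic n f → ∀ e c → Periodic n (λ z → f (e · z + c))
periodic-affine {n} {f} f-periodic Sign.+ c z =
  trans (cong f (solve 3 (λ z n c → z :+ n :+ c := z :+ c :+ n) refl z (+ n) c)) (f-periodic (z + c))
periodic-affine {n} {f} f-periodic Sign.- c z = sym (begin
  f (- z + c)                ≡⟨ cong f (solve 3 (λ z n c → :- z :+ c := :- (z :+ n) :+ c :+ n) refl z (+ n) c) ⟩
  f (- (z + + n) + c + + n)  ≡⟨ f-periodic _ ⟩
  f (- (z + + n) + c)        ∎)

periodic-* : ∀ {n f g} → Periodic n f → Periodic n g → Periodic n (λ z → f z * g z)
periodic-* f-periodic g-periodic z = cong₂ _*_ (f-periodic z) (g-periodic z)

periodSum : ℕ → (ℤ → ℤ) → ℤ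
periodSum n f = ∑ (λ (u : Fin n) → f (+ toℕ u))

periodSum-cong : ∀ n {f g} → (∀ z → f z ≡ g z) → periodSum n f ≡ periodSum n g
periodSum-cong n f≗g = ∑-cong {n} (λ u → f≗g (+ toℕ u))

periodSum-rotate : ∀ {n f} → Periodic n f → periodSum n (λ z → f (z + 1ℤ)) ≡ periodSum n f
periodSum-rotate {zero}      f-periodic = refl
periodSum-rotate {suc n} {f} f-periodic = begin
  periodSum (suc n) (λ z → f (z + 1ℤ))
    ≡⟨ sum-init-last {n} (λ u → f (+ toℕ u + 1ℤ)) ⟩
  ∑ (λ (u : Fin n) → f (+ toℕ (Fin.inject₁ u) + 1ℤ)) + f (+ toℕ (Fin.fromℕ n) + 1ℤ)
    ≡⟨ cong₂ _+_ (∑-cong λ u → cong f (shift u)) wrap ⟩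
  ∑ (λ (u : Fin n) → f (1ℤ + + toℕ u)) + f 0ℤ
    ≡⟨ ℤ.+-comm _ (f 0ℤ) ⟩
  periodSum (suc n) f ∎
  where
  shift : ∀ (u : Fin n) → + toℕ (Fin.inject₁ u) + 1ℤ ≡ 1ℤ + + toℕ u
  shift u = trans (cong (λ m → + m + 1ℤ) (toℕ-inject₁ u)) (ℤ.+-comm (+ toℕ u) 1ℤ)

  wrap : f (+ toℕ (Fin.fromℕ n) + 1ℤ) ≡ f 0ℤ
  wrap = trans (cong f (trans (cong (λ m → + m + 1ℤ) (toℕ-fromℕ n)) (ℤ.+-comm (+ n) 1ℤ)))
               (f-periodic 0ℤ)

periodSum-translate⁺ : ∀ {n f} → Periodic n f → ∀ k → periodSum n (λ z → f (z + + k)) ≡ periodSum n f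
periodSum-translate⁺ {n} {f} f-periodic zero    = periodSum-cong n λ z → cong f (ℤ.+-identityʳ z)
periodSum-translate⁺ {n} {f} f-periodic (suc k) = begin
  periodSum n (λ z → f (z + + suc k))   ≡⟨ periodSum-cong n (λ z → cong f (sym (ℤ.+-assoc z 1ℤ (+ k)))) ⟩
  periodSum n (λ z → f (z + 1ℤ + + k))  ≡⟨ periodSum-rotate (periodic-affine f-periodic Sign.+ (+ k)) ⟩
  periodSum n (λ z → f (z + + k))       ≡⟨ periodSum-translate⁺ f-periodic k ⟩
  periodSum n f                         ∎

periodSum-translate : ∀ {n f} → Periodic n f → ∀ c → periodSum n (λ z → f (z + c)) ≡ periodSum n f
periodSum-translate f-periodic (+ k) = periodSum-translate⁺ f-periodic k
periodSum-translate {n} {f} f-periodic -[1+ k ] = sym (begin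
  periodSum n f                                   ≡⟨ periodSum-cong n (λ z → cong f (sym (cancel z))) ⟩
  periodSum n (λ z → f (z + + suc k + -[1+ k ]))  ≡⟨ periodSum-translate⁺ f-periodic′ (suc k) ⟩
  periodSum n (λ z → f (z + -[1+ k ]))            ∎)
  where
  f-periodic′ = periodic-affine f-periodic Sign.+ -[1+ k ]

  cancel : ∀ z → z + + suc k + -[1+ k ] ≡ z
  cancel z = solve 2 (λ z m → z :+ m :- m := z) refl z (+ suc k)

periodSum-reflect : ∀ {n f} → Periodic n f → periodSum n (λ z → f (- z)) ≡ periodSum n f
periodSum-reflect {zero}      f-periodic = refl
periodSum-reflect {suc n} {f} f-periodic = begin
  periodSum (suc n) (λ z → f (- z))                        ≡⟨ ∑-permute (λ u → f (- + toℕ u)) Perm.reverse ⟩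
  ∑ (λ (u : Fin (suc n)) → f (- + toℕ (Fin.opposite u)))  ≡⟨ ∑-cong (λ u → cong f (reflect u)) ⟩
  periodSum (suc n) (λ z → f (z + - + n))                  ≡⟨ periodSum-translate f-periodic (- + n) ⟩
  periodSum (suc n) f                                      ∎
  where
  reflect : ∀ (u : Fin (suc n)) → - + toℕ (Fin.opposite u) ≡ + toℕ u + - + n
  reflect u = begin
    - + toℕ (Fin.opposite u)  ≡⟨ cong (λ m → - + m) (opposite-prop u) ⟩
    - + (n ℕ.∸ toℕ u)         ≡⟨ cong -_ (ℤ.⊖-≥ (ℕ.s≤s⁻¹ (toℕ<n u))) ⟨
    - (n ℤ.⊖ toℕ u)           ≡⟨ cong -_ (ℤ.m-n≡m⊖n n (toℕ u)) ⟨
    - (+ n - + toℕ u)         ≡⟨ solve 2 (λ n u → :- (n :- u) := u :- n) refl (+ n) (+ toℕ u) ⟩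
    + toℕ u + - + n           ∎

periodSum-affine : ∀ {n f} → Periodic n f → ∀ e c → periodSum n (λ z → f (e · z + c)) ≡ periodSum n f
periodSum-affine f-periodic Sign.+ c = periodSum-translate f-periodic c
periodSum-affine f-periodic Sign.- c =
  trans (periodSum-reflect (periodic-affine f-periodic Sign.+ c)) (periodSum-translate f-periodic c)

correlation : ℕ → (ℤ → ℤ) → (ℤ → ℤ) → Sign → ℤ → ℤ
correlation n p q e t = periodSum n (λ u → p u * q (e · u + t))

autocorrelation : ℕ → (ℤ → ℤ) → ℤ → ℤ
autocorrelation n p t = correlation n p p Sign.+ t

correlation-affine : ∀ {n p q} → Periodic n p → Periodic n q → ∀ e₁ d₁ e₂ d₂ →
  periodSum n (λ y → p (e₁ · y + d₁) * q (e₂ · y + d₂)) ≡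
  correlation n p q (e₁ Sign.* e₂) (d₂ - (e₁ Sign.* e₂) · d₁)
correlation-affine {n} {p} {q} p-periodic q-periodic e₁ d₁ e₂ d₂ = trans
  (periodSum-cong n λ y → cong (λ w → p (e₁ · y + d₁) * q w) (sym (realign e₁ e₂ y)))
  (periodSum-affine (periodic-* p-periodic (periodic-affine q-periodic (e₁ Sign.* e₂) _)) e₁ d₁)
  where
  realign : ∀ e₁ e₂ y → (e₁ Sign.* e₂) · (e₁ · y + d₁) + (d₂ - (e₁ Sign.* e₂) · d₁) ≡ e₂ · y + d₂
  realign Sign.+ Sign.+ y = solve 3 (λ y a b → y :+ a :+ (b :- a) := y :+ b) refl y d₁ d₂
  realign Sign.+ Sign.- y = solve 3 (λ y a b → :- (y :+ a) :+ (b :- :- a) := :- y :+ b) refl y d₁ d₂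
  realign Sign.- Sign.+ y = solve 3 (λ y a b → :- (:- y :+ a) :+ (b :- :- a) := y :+ b) refl y d₁ d₂
  realign Sign.- Sign.- y = solve 3 (λ y a b → :- y :+ a :+ (b :- a) := :- y :+ b) refl y d₁ d₂

correlation-swap : ∀ {n p q} → Periodic n p → Periodic n q → ∀ e t →
                   correlation n p q e t ≡ correlation n q p e (- (e · t))
correlation-swap {n} {p} {q} p-periodic q-periodic e t = begin
  correlation n p q e t
    ≡⟨ periodSum-cong n (λ u → trans (ℤ.*-comm (p u) (q (e · u + t)))
                                      (cong (λ w → q (e · u + t) * p w) (sym (ℤ.+-identityʳ u)))) ⟩
  periodSum n (λ u → q (e · u + t) * p (Sign.+ · u + 0ℤ))
    ≡⟨ correlation-affine q-periodic p-periodic e t Sign.+ 0ℤ ⟩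
  correlation n q p (e Sign.* Sign.+) (0ℤ - (e Sign.* Sign.+) · t)
    ≡⟨ cong (λ e′ → correlation n q p e′ (0ℤ - e′ · t)) (Sign.*-identityʳ e) ⟩
  correlation n q p e (0ℤ - e · t)
    ≡⟨ cong (correlation n q p e) (ℤ.+-identityˡ _) ⟩
  correlation n q p e (- (e · t)) ∎

autocorrelation-even : ∀ {n p} → Periodic n p → ∀ t → autocorrelation n p t ≡ autocorrelation n p (- t)
autocorrelation-even p-periodic = correlation-swap p-periodic p-periodic Sign.+

autocorrelation-±1-0 : ∀ {n p} → (∀ z → PlusMinusOne (p z)) → autocorrelation n p 0ℤ ≡ + n
autocorrelation-±1-0 {n} {p} p-±1 = trans
  (periodSum-cong n (λ u → trans (cong (λ w → p u * p w) (ℤ.+-identityʳ u)) (±1*±1≡1 (p-±1 u))))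
  (∑-const-1 n)

difference-elim : ∀ {n} (P : ℤ → Set) → (∀ t → P t → P (- t)) →
                  (∀ {r} → 0 ℕ.< r → r ℕ.< n → P (+ r)) →
                  ∀ (x y : Fin n) → x ≢ y → P (+ toℕ x - + toℕ y)
difference-elim {n} P P-neg P-range x y x≢y = by-order (ℕ.<-cmp (toℕ x) (toℕ y))
  where
  positive : ∀ (x y : Fin n) → toℕ y ℕ.< toℕ x → P (+ toℕ x - + toℕ y)
  positive x y y<x = subst P (sym (trans (ℤ.m-n≡m⊖n (toℕ x) (toℕ y)) (ℤ.⊖-≥ (ℕ.<⇒≤ y<x))))
    (P-range (ℕ.m<n⇒0<n∸m y<x) (ℕ.≤-<-trans (ℕ.m∸n≤m (toℕ x) (toℕ y)) (toℕ<n x)))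

  by-order : Tri (toℕ x ℕ.< toℕ y) (toℕ x ≡ toℕ y) (toℕ y ℕ.< toℕ x) → P (+ toℕ x - + toℕ y)
  by-order (tri< x<y _ _) = subst P (solve 2 (λ x y → :- (y :- x) := x :- y) refl (+ toℕ x) (+ toℕ y))
                              (P-neg _ (positive y x x<y))
  by-order (tri≈ _ x≡y _) = contradiction (toℕ-injective x≡y) x≢y
  by-order (tri> _ _ y<x) = positive x y y<x

blockMatrix : ∀ {m n} → (Fin m → Fin m → Fin n → Fin n → ℤ) → Matrix (m ℕ.* n)
blockMatrix {m} {n} B i j =
  B (proj₁ (remQuot {m} n i)) (proj₁ (remQuot {m} n j)) (proj₂ (remQuot {m} n i)) (proj₂ (remQuot {m} n j))

blockMatrix-entries : ∀ {m n} (P : ℤ → Set) (B : Fin m → Fin m → Fin n → Fin n → ℤ) →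
                      (∀ a b x y → P (B a b x y)) → ∀ i j → P (blockMatrix B i j)
blockMatrix-entries P B P-B i j = P-B _ _ _ _

blockMatrix-combine : ∀ {m n} (B : Fin m → Fin m → Fin n → Fin n → ℤ) a b x y →
                      blockMatrix B (combine a x) (combine b y) ≡ B a b x y
blockMatrix-combine B a b x y =
  cong₂ (λ (a , x) (b , y) → B a b x y) (remQuot-combine a x) (remQuot-combine b y)

blockwise : ∀ {m n} (P : Fin (m ℕ.* n) → Fin (m ℕ.* n) → Set) →
            (∀ (a b : Fin m) (x y : Fin n) → P (combine a x) (combine b y)) → ∀ i j → P i j
blockwise {m} {n} P P-combine i j =
  subst₂ P (combine-remQuot {m} n i) (combine-remQuot {m} n j) (P-combine _ _ _ _)

*ᵀ-blockMatrix : ∀ {m n} (B : Fin m → Fin m → Fin n → Fin n → ℤ) a b x y →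
                 (blockMatrix B *ᵀ) (combine a x) (combine b y) ≡ ∑ (λ c → ∑ (λ z → B a c x z * B b c y z))
*ᵀ-blockMatrix {m} B a b x y = trans (∑-combine m _)
  (∑-cong λ c → ∑-cong λ z → cong₂ _*_ (blockMatrix-combine B a c x z) (blockMatrix-combine B b c y z))

scalarI-diagonal : ∀ {n} c (i : Fin n) → scalarI c i i ≡ c
scalarI-diagonal c i with i Fin.≟ i
... | yes _   = refl
... | no i≢i = contradiction refl i≢i

scalarI-offDiagonal : ∀ {n} c {i j : Fin n} → i ≢ j → scalarI c i j ≡ 0ℤ
scalarI-offDiagonal c {i} {j} i≢j with i Fin.≟ j
... | yes i≡j = contradiction i≡j i≢j
... | no _    = refl

scalarI-blockwise : ∀ {m n} (N : Matrix (m ℕ.* n)) c →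
  (∀ (a : Fin m) (x : Fin n) → N (combine a x) (combine a x) ≡ c) →
  (∀ (a b : Fin m) (x y : Fin n) → a ≢ b → N (combine a x) (combine b y) ≡ 0ℤ) →
  (∀ (a : Fin m) (x y : Fin n) → x ≢ y → N (combine a x) (combine a y) ≡ 0ℤ) →
  ∀ i j → N i j ≡ scalarI c i j
scalarI-blockwise {m} {n} N c diagonal offBlock offDiagonal =
  blockwise (λ i j → N i j ≡ scalarI c i j) entry
  where
  entry : ∀ (a b : Fin m) (x y : Fin n) → N (combine a x) (combine b y) ≡ scalarI c (combine a x) (combine b y)
  entry a b x y with a Fin.≟ b | x Fin.≟ y
  ... | yes refl | yes refl = trans (diagonal a x) (sym (scalarI-diagonal c _))
  ... | yes refl | no x≢y  =
    trans (offDiagonal a x y x≢y) (sym (scalarI-offDiagonal c (x≢y ∘ combine-injectiveʳ a x a y)))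
  ... | no a≢b   | _       =
    trans (offBlock a b x y a≢b) (sym (scalarI-offDiagonal c (a≢b ∘ combine-injectiveˡ a x b y)))

record Block (k : ℕ) : Set where
  constructor block
  field
    sign     : Sign
    sequence : Fin k
    rowSign  : Sign
    colSign  : Sign

open Block

Cancelling : ∀ {k} → Block k → Block k → Block k → Block k → Set
Cancelling β₁ β₂ γ₁ γ₂ =
  sequence γ₁ ≡ sequence β₂ × sequence γ₂ ≡ sequence β₁ ×
  colSign γ₁ Sign.* colSign γ₂ ≡ e ×
  sign γ₁ Sign.* sign γ₂ ≡ opposite (sign β₁ Sign.* sign β₂) ×
  rowSign γ₁ ≡ opposite (e Sign.* rowSign β₁) × rowSign γ₂ ≡ opposite (e Sign.* rowSign β₂)
  where e = colSign β₁ Sign.* colSign β₂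

cancelling? : ∀ {k} (β₁ β₂ γ₁ γ₂ : Block k) → Dec (Cancelling β₁ β₂ γ₁ γ₂)
cancelling? β₁ β₂ γ₁ γ₂ =
  sequence γ₁ Fin.≟ sequence β₂ ×-dec sequence γ₂ Fin.≟ sequence β₁ ×-dec
  colSign γ₁ Sign.* colSign γ₂ Sign.≟ e ×-dec
  sign γ₁ Sign.* sign γ₂ Sign.≟ opposite (sign β₁ Sign.* sign β₂) ×-dec
  rowSign γ₁ Sign.≟ opposite (e Sign.* rowSign β₁) ×-dec rowSign γ₂ Sign.≟ opposite (e Sign.* rowSign β₂)
  where e = colSign β₁ Sign.* colSign β₂

SkewPair : ∀ {k} → Block k → Block k → Set
SkewPair β γ =
  sequence γ ≡ sequence β × sign γ ≡ opposite (sign β) × rowSign γ ≡ colSign β × colSign γ ≡ rowSign β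

skewPair? : ∀ {k} (β γ : Block k) → Dec (SkewPair β γ)
skewPair? β γ =
  sequence γ Fin.≟ sequence β ×-dec sign γ Sign.≟ opposite (sign β) ×-dec
  rowSign γ Sign.≟ colSign β ×-dec colSign γ Sign.≟ rowSign β

module BlockAlgebra {k n} (s : Fin k → ℤ → ℤ) (s-periodic : ∀ i → Periodic n (s i)) where

  entry : Block k → ℤ → ℤ → ℤ
  entry β x y = sign β · s (sequence β) (colSign β · y + rowSign β · x)

  entry-±1 : (∀ i z → PlusMinusOne (s i z)) → ∀ β x y → PlusMinusOne (entry β x y)
  entry-±1 s-±1 β x y = ·-±1 (sign β) (s-±1 _ _)

  entry-skew : ∀ {β γ} → SkewPair β γ → ∀ x y → entry β x y + entry γ y x ≡ 0ℤ
  entry-skew {β} {γ} (k≡ , σ≡ , r≡ , c≡) x y rewrite k≡ | σ≡ | r≡ | c≡ = begin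
    v + opposite (sign β) · s (sequence β) (rowSign β · x + colSign β · y)
      ≡⟨ cong (_+_ v) (opposite-· (sign β) _) ⟩
    v + - (sign β · s (sequence β) (rowSign β · x + colSign β · y))
      ≡⟨ cong (λ w → v + - (sign β · s (sequence β) w)) (ℤ.+-comm (rowSign β · x) _) ⟩
    v + - v
      ≡⟨ ℤ.+-inverseʳ v ⟩
    0ℤ ∎
    where v = entry β x y

  rowProduct : Block k → Block k → ℤ → ℤ → ℤ
  rowProduct β γ x x′ = periodSum n (λ y → entry β x y * entry γ x′ y)

  blockCorrelation : Sign → Fin k → Fin k → Sign → Sign → Sign → ℤ → ℤ → ℤ
  blockCorrelation σ k₁ k₂ e r₁ r₂ x x′ = σ · correlation n (s k₁) (s k₂) e (r₂ · x′ - e · (r₁ · x))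

  rowProduct-correlation : ∀ β γ x x′ → rowProduct β γ x x′ ≡
    blockCorrelation (sign β Sign.* sign γ) (sequence β) (sequence γ)
                     (colSign β Sign.* colSign γ) (rowSign β) (rowSign γ) x x′
  rowProduct-correlation β γ x x′ = begin
    periodSum n (λ y → (sign β · p y) * (sign γ · q y))
      ≡⟨ periodSum-cong n (λ y → ·-*-· (sign β) (sign γ) (p y) (q y)) ⟩
    periodSum n (λ y → σ · (p y * q y))
      ≡⟨ ∑-· σ (λ (u : Fin n) → p (+ toℕ u) * q (+ toℕ u)) ⟩
    σ · periodSum n (λ y → p y * q y)
      ≡⟨ cong (σ ·_) (correlation-affine (s-periodic _) (s-periodic _)
                        (colSign β) (rowSign β · x) (colSign γ) (rowSign γ · x′)) ⟩
    blockCorrelation σ (sequence β) (sequence γ) (colSign β Sign.* colSign γ) (rowSign β) (rowSign γ) x x′ ∎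
    where
    σ = sign β Sign.* sign γ

    p q : ℤ → ℤ
    p y = s (sequence β) (colSign β · y + rowSign β · x)
    q y = s (sequence γ) (colSign γ · y + rowSign γ · x′)

  rowProduct-self : ∀ β x x′ → rowProduct β β x x′ ≡ autocorrelation n (s (sequence β)) (x - x′)
  rowProduct-self β x x′ = trans (rowProduct-correlation β β x x′) squares
    where
    p = s (sequence β)

    lag : ∀ r → correlation n p p Sign.+ (r · x′ - r · x) ≡ autocorrelation n p (x - x′)
    lag Sign.+ = trans (autocorrelation-even (s-periodic _) (x′ - x))
                       (cong (autocorrelation n p) (solve 2 (λ x x′ → :- (x′ :- x) := x :- x′) refl x x′))
    lag Sign.- = cong (autocorrelation n p) (solve 2 (λ x x′ → :- x′ :- :- x := x :- x′) refl x x′)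

    squares : blockCorrelation (sign β Sign.* sign β) (sequence β) (sequence β)
                (colSign β Sign.* colSign β) (rowSign β) (rowSign β) x x′ ≡ autocorrelation n p (x - x′)
    squares rewrite Sign.s*s≡+ (sign β) | Sign.s*s≡+ (colSign β) = lag (rowSign β)

  blockCorrelation-cancel : ∀ σ k₁ k₂ e r₁ r₂ x x′ →
    blockCorrelation (opposite σ) k₂ k₁ e (opposite (e Sign.* r₁)) (opposite (e Sign.* r₂)) x x′ ≡
    - blockCorrelation σ k₁ k₂ e r₁ r₂ x x′
  blockCorrelation-cancel σ k₁ k₂ e r₁ r₂ x x′ = begin
    opposite σ · correlation n (s k₂) (s k₁) e (opposite (e Sign.* r₂) · x′ - e · (opposite (e Sign.* r₁) · x))
      ≡⟨ cong (λ t → opposite σ · correlation n (s k₂) (s k₁) e t) lag ⟩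
    opposite σ · correlation n (s k₂) (s k₁) e (- (e · t))
      ≡⟨ cong (opposite σ ·_) (correlation-swap (s-periodic k₁) (s-periodic k₂) e t) ⟨
    opposite σ · correlation n (s k₁) (s k₂) e t
      ≡⟨ opposite-· σ _ ⟩
    - blockCorrelation σ k₁ k₂ e r₁ r₂ x x′ ∎
    where
    t = r₂ · x′ - e · (r₁ · x)

    flip : ∀ r z → opposite (e Sign.* r) · z ≡ - (e · (r · z))
    flip r z = trans (opposite-· (e Sign.* r) z) (cong -_ (*-· e r z))

    lag′ : ∀ e a b → - (e · a) - e · (- (e · b)) ≡ - (e · (a - e · b))
    lag′ Sign.+ a b = solve 2 (λ a b → :- a :- :- b := :- (a :- b)) refl a b
    lag′ Sign.- a b = solve 2 (λ a b → :- :- a :- :- :- :- b := :- :- (a :- :- b)) refl a b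

    lag : opposite (e Sign.* r₂) · x′ - e · (opposite (e Sign.* r₁) · x) ≡ - (e · t)
    lag = trans (cong₂ (λ a b → a - e · b) (flip r₂ x′) (flip r₁ x)) (lag′ e (r₂ · x′) (r₁ · x))

  rowProduct-cancelling : ∀ β₁ β₂ γ₁ γ₂ → Cancelling β₁ β₂ γ₁ γ₂ →
                          ∀ x x′ → rowProduct γ₁ γ₂ x x′ ≡ - rowProduct β₁ β₂ x x′
  rowProduct-cancelling β₁ β₂ γ₁ γ₂ (k₁≡ , k₂≡ , e≡ , σ≡ , r₁≡ , r₂≡) x x′ =
    trans (rowProduct-correlation γ₁ γ₂ x x′)
          (trans transported (cong -_ (sym (rowProduct-correlation β₁ β₂ x x′))))
    where
    transported : blockCorrelation (sign γ₁ Sign.* sign γ₂) (sequence γ₁) (sequence γ₂)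
                                   (colSign γ₁ Sign.* colSign γ₂) (rowSign γ₁) (rowSign γ₂) x x′ ≡
                  - blockCorrelation (sign β₁ Sign.* sign β₂) (sequence β₁) (sequence β₂)
                                     (colSign β₁ Sign.* colSign β₂) (rowSign β₁) (rowSign β₂) x x′
    transported rewrite k₁≡ | k₂≡ | e≡ | σ≡ | r₁≡ | r₂≡ =
      blockCorrelation-cancel (sign β₁ Sign.* sign β₂) (sequence β₁) (sequence β₂)
                              (colSign β₁ Sign.* colSign β₂) (rowSign β₁) (rowSign β₂) x x′

-- With X the circulant matrix (s (y - x))ₓᵧ of a sequence s and R the reflection matrix
-- [x + y ≡ 0 (mod n)]ₓᵧ: circ = X, circR = XR and circᵀR = XᵀR.
circ circR circᵀR : Fin 4 → Block 4
circ   k = block Sign.+ k Sign.- Sign.+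
circR  k = block Sign.+ k Sign.- Sign.-
circᵀR k = block Sign.+ k Sign.+ Sign.+

⊖_ : ∀ {k} → Block k → Block k
⊖ β = record β { sign = opposite (sign β) }

goethalsSeidel : Fin 4 → Fin 4 → Block 4
goethalsSeidel 0F 0F = circ 0F
goethalsSeidel 0F 1F = circR 1F
goethalsSeidel 0F 2F = circR 2F
goethalsSeidel 0F 3F = circR 3F
goethalsSeidel 1F 0F = ⊖ circR 1F
goethalsSeidel 1F 1F = circ 0F
goethalsSeidel 1F 2F = circᵀR 3F
goethalsSeidel 1F 3F = ⊖ circᵀR 2F
goethalsSeidel 2F 0F = ⊖ circR 2F
goethalsSeidel 2F 1F = ⊖ circᵀR 3F
goethalsSeidel 2F 2F = circ 0F
goethalsSeidel 2F 3F = circᵀR 1F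
goethalsSeidel 3F 0F = ⊖ circR 3F
goethalsSeidel 3F 1F = circᵀR 2F
goethalsSeidel 3F 2F = ⊖ circᵀR 1F
goethalsSeidel 3F 3F = circ 0F

goethalsSeidel-diagonal : ∀ a → goethalsSeidel a a ≡ circ 0F
goethalsSeidel-diagonal 0F = refl
goethalsSeidel-diagonal 1F = refl
goethalsSeidel-diagonal 2F = refl
goethalsSeidel-diagonal 3F = refl

goethalsSeidel-sequence-involutive : ∀ a b → sequence (goethalsSeidel a (sequence (goethalsSeidel a b))) ≡ b
goethalsSeidel-sequence-involutive = from-yes (all? λ a → all? λ b →
  sequence (goethalsSeidel a (sequence (goethalsSeidel a b))) Fin.≟ b)

-- sequence (goethalsSeidel a b) is a ⊕ b in the Klein four-group on Fin 4,
-- so partner a a′ b = a ⊕ a′ ⊕ b.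
partner : Fin 4 → Fin 4 → Fin 4 → Fin 4
partner a a′ b = sequence (goethalsSeidel a′ (sequence (goethalsSeidel a b)))

partner-involutive : ∀ a a′ b → partner a a′ (partner a a′ b) ≡ b
partner-involutive = from-yes (all? λ a → all? λ a′ → all? λ b → partner a a′ (partner a a′ b) Fin.≟ b)

goethalsSeidel-cancelling : ∀ a a′ → a ≢ a′ → ∀ b →
  Cancelling (goethalsSeidel a b) (goethalsSeidel a′ b)
             (goethalsSeidel a (partner a a′ b)) (goethalsSeidel a′ (partner a a′ b))
goethalsSeidel-cancelling = from-yes (all? λ a → all? λ a′ → ¬? (a Fin.≟ a′) →-dec all? λ b →
  cancelling? (goethalsSeidel a b) (goethalsSeidel a′ b)
              (goethalsSeidel a (partner a a′ b)) (goethalsSeidel a′ (partner a a′ b)))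

goethalsSeidel-skew : ∀ a b → a ≢ b → SkewPair (goethalsSeidel a b) (goethalsSeidel b a)
goethalsSeidel-skew = from-yes (all? λ a → all? λ b → ¬? (a Fin.≟ b) →-dec
  skewPair? (goethalsSeidel a b) (goethalsSeidel b a))

record SkewGoethalsSeidelSequences (n : ℕ) : Set where
  field
    s            : Fin 4 → ℤ → ℤ
    s-periodic   : ∀ k → Periodic n (s k)
    s-±1         : ∀ k z → PlusMinusOne (s k z)
    paf-vanishes : ∀ {r} → 0 ℕ.< r → r ℕ.< n → ∑ (λ k → autocorrelation n (s k) (+ r)) ≡ 0ℤ
    s₀-origin    : s 0F 0ℤ ≡ 1ℤ
    s₀-skew      : ∀ {r} → 0 ℕ.< r → r ℕ.< n → s 0F (+ r) + s 0F (- + r) ≡ 0ℤ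

module GoethalsSeidel {n} (S : SkewGoethalsSeidelSequences n) where
  open SkewGoethalsSeidelSequences S
  open BlockAlgebra s s-periodic

  blocks : Fin 4 → Fin 4 → Fin n → Fin n → ℤ
  blocks a b x y = entry (goethalsSeidel a b) (+ toℕ x) (+ toℕ y)

  matrix : Matrix (4 ℕ.* n)
  matrix = blockMatrix blocks

  paf : ℤ → ℤ
  paf t = ∑ (λ k → autocorrelation n (s k) t)

  paf-offDiagonal : ∀ (x x′ : Fin n) → x ≢ x′ → paf (+ toℕ x - + toℕ x′) ≡ 0ℤ
  paf-offDiagonal = difference-elim (λ t → paf t ≡ 0ℤ) paf-even paf-vanishes
    where
    paf-even : ∀ t → paf t ≡ 0ℤ → paf (- t) ≡ 0ℤ
    paf-even t pafₜ≡0 = trans (sym (∑-cong λ k → autocorrelation-even (s-periodic k) t)) pafₜ≡0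

  gram-sameBlockRow : ∀ a x x′ →
    ∑ (λ b → rowProduct (goethalsSeidel a b) (goethalsSeidel a b) x x′) ≡ paf (x - x′)
  gram-sameBlockRow a x x′ = trans (∑-cong λ b → rowProduct-self (goethalsSeidel a b) x x′)
    (∑-involution (λ b → sequence (goethalsSeidel a b)) (goethalsSeidel-sequence-involutive a)
                  (λ k → autocorrelation n (s k) (x - x′)))

  gram-otherBlockRow : ∀ a a′ → a ≢ a′ → ∀ x x′ →
    ∑ (λ b → rowProduct (goethalsSeidel a b) (goethalsSeidel a′ b) x x′) ≡ 0ℤ
  gram-otherBlockRow a a′ a≢a′ x x′ =
    signReversingInvolution⇒∑≡0 (partner a a′) (partner-involutive a a′)
      (λ b → rowProduct (goethalsSeidel a b) (goethalsSeidel a′ b) x x′)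
      (λ b → let b′ = partner a a′ b in
        rowProduct-cancelling (goethalsSeidel a b) (goethalsSeidel a′ b)
                              (goethalsSeidel a b′) (goethalsSeidel a′ b′)
                              (goethalsSeidel-cancelling a a′ a≢a′ b) x x′)

  gram : ∀ i j → (matrix *ᵀ) i j ≡ scalarI (+ (4 ℕ.* n)) i j
  gram = scalarI-blockwise (matrix *ᵀ) _
    (λ a x → begin
      (matrix *ᵀ) (combine a x) (combine a x)  ≡⟨ *ᵀ-blockMatrix blocks a a x x ⟩
      ∑ (λ b → rowProduct (goethalsSeidel a b) (goethalsSeidel a b) (+ toℕ x) (+ toℕ x))
                                               ≡⟨ gram-sameBlockRow a (+ toℕ x) (+ toℕ x) ⟩
      paf (+ toℕ x - + toℕ x)                  ≡⟨ cong paf (ℤ.+-inverseʳ (+ toℕ x)) ⟩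
      paf 0ℤ                                   ≡⟨ ∑-cong (λ k → autocorrelation-±1-0 {n} (s-±1 k)) ⟩
      + (4 ℕ.* n)                              ∎)
    (λ a b x y a≢b → trans (*ᵀ-blockMatrix blocks a b x y)
                           (gram-otherBlockRow a b a≢b (+ toℕ x) (+ toℕ y)))
    (λ a x y x≢y → trans (*ᵀ-blockMatrix blocks a a x y)
                         (trans (gram-sameBlockRow a (+ toℕ x) (+ toℕ y)) (paf-offDiagonal x y x≢y)))

  blocks-diagonal : ∀ a x y → blocks a a x y ≡ s 0F (+ toℕ y - + toℕ x)
  blocks-diagonal a x y rewrite goethalsSeidel-diagonal a = refl

  s₀-antisymmetric : ∀ (x y : Fin n) → x ≢ y → s 0F (+ toℕ x - + toℕ y) + s 0F (+ toℕ y - + toℕ x) ≡ 0ℤ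
  s₀-antisymmetric x y x≢y = subst (λ t → s 0F (+ toℕ x - + toℕ y) + s 0F t ≡ 0ℤ)
    (solve 2 (λ x y → :- (x :- y) := y :- x) refl (+ toℕ x) (+ toℕ y))
    (difference-elim (λ t → s 0F t + s 0F (- t) ≡ 0ℤ) odd s₀-skew x y x≢y)
    where
    odd : ∀ t → s 0F t + s 0F (- t) ≡ 0ℤ → s 0F (- t) + s 0F (- - t) ≡ 0ℤ
    odd t sₜ+s₋ₜ≡0 = trans (cong (λ w → s 0F (- t) + s 0F w) (ℤ.neg-involutive t))
                           (trans (ℤ.+-comm (s 0F (- t)) (s 0F t)) sₜ+s₋ₜ≡0)

  skew : ∀ i j → matrix i j + matrix j i ≡ scalarI (+ 2) i j
  skew = scalarI-blockwise (λ i j → matrix i j + matrix j i) (+ 2)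
    (λ a x → begin
      matrix (combine a x) (combine a x) + matrix (combine a x) (combine a x)
        ≡⟨ cong (λ v → v + v) (trans (blockMatrix-combine blocks a a x x) (blocks-diagonal a x x)) ⟩
      s 0F (+ toℕ x - + toℕ x) + s 0F (+ toℕ x - + toℕ x)
        ≡⟨ cong (λ v → s 0F v + s 0F v) (ℤ.+-inverseʳ (+ toℕ x)) ⟩
      s 0F 0ℤ + s 0F 0ℤ
        ≡⟨ cong (λ v → v + v) s₀-origin ⟩
      + 2 ∎)
    (λ a b x y a≢b → trans (cong₂ _+_ (blockMatrix-combine blocks a b x y) (blockMatrix-combine blocks b a y x))
                           (entry-skew (goethalsSeidel-skew a b a≢b) (+ toℕ x) (+ toℕ y)))
    (λ a x y x≢y → trans (cong₂ _+_ (trans (blockMatrix-combine blocks a a x y) (blocks-diagonal a x y))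
                                    (trans (blockMatrix-combine blocks a a y x) (blocks-diagonal a y x)))
                         (s₀-antisymmetric y x (x≢y ∘ sym)))

  skewHadamard : ∃ λ (M : Matrix (4 ℕ.* n)) → IsSkewHadamard (4 ℕ.* n) M
  skewHadamard = matrix ,
    blockMatrix-entries PlusMinusOne blocks (λ a b x y → entry-±1 s-±1 (goethalsSeidel a b) _ _) ,
    gram , skew

residue : (n : ℕ) .{{_ : ℕ.NonZero n}} → ℤ → ℕ
residue n (+ m)    = m ℕ.% n
residue n -[1+ m ] = n ℕ.∸ suc (m ℕ.% n)

residue-periodic : ∀ n .{{_ : ℕ.NonZero n}} z → residue n (z + + n) ≡ residue n z
residue-periodic n (+ m)    = ℕ.[m+n]%n≡m%n m n
residue-periodic n -[1+ m ] with m ℕ.<? n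
... | yes m<n = begin
  residue n (n ℤ.⊖ suc m)  ≡⟨ cong (residue n) (ℤ.⊖-≥ m<n) ⟩
  (n ℕ.∸ suc m) ℕ.% n      ≡⟨ ℕ.m<n⇒m%n≡m (ℕ.∸-monoʳ-< ℕ.z<s m<n) ⟩
  n ℕ.∸ suc m              ≡⟨ cong (λ r → n ℕ.∸ suc r) (ℕ.m<n⇒m%n≡m m<n) ⟨
  n ℕ.∸ suc (m ℕ.% n)      ∎
... | no m≮n = begin
  residue n (n ℤ.⊖ suc m)
    ≡⟨ cong (residue n) (trans (ℤ.⊖-< (ℕ.s≤s n≤m)) (cong (λ k → - + k) (ℕ.+-∸-assoc 1 n≤m))) ⟩
  n ℕ.∸ suc ((m ℕ.∸ n) ℕ.% n)
    ≡⟨ cong (λ r → n ℕ.∸ suc r) (ℕ.m≤n⇒[n∸m]%m≡n%m n≤m) ⟩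
  n ℕ.∸ suc (m ℕ.% n) ∎
  where n≤m = ℕ.≮⇒≥ m≮n

extend : (n : ℕ) .{{_ : ℕ.NonZero n}} → (ℕ → Sign) → ℤ → ℤ
extend n f z = f (residue n z) · 1ℤ

extend-periodic : ∀ n .{{_ : ℕ.NonZero n}} f → Periodic n (extend n f)
extend-periodic n f z = cong (λ r → f r · 1ℤ) (residue-periodic n z)

extend-±1 : ∀ n .{{_ : ℕ.NonZero n}} f z → PlusMinusOne (extend n f z)
extend-±1 n f z = ·-±1 (f (residue n z)) (inj₁ refl)

sumRange : (ℕ → ℤ) → ℕ → ℕ → ℤ
sumRange f m zero    = 0ℤ
sumRange f m (suc k) = f m + sumRange f (suc m) k

∑-sumRange : ∀ k m (f : ℕ → ℤ) → ∑ (λ (u : Fin k) → f (m ℕ.+ toℕ u)) ≡ sumRange f m k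
∑-sumRange zero    m f = refl
∑-sumRange (suc k) m f = cong₂ _+_ (cong f (ℕ.+-identityʳ m))
  (trans (∑-cong {k} (λ u → cong f (ℕ.+-suc m (toℕ u)))) (∑-sumRange k (suc m) f))

periodSum-sumRange : ∀ n f → periodSum n f ≡ sumRange (λ m → f (+ m)) 0 n
periodSum-sumRange n f = ∑-sumRange n 0 (λ m → f (+ m))

∀Fin⇒∀positive< : ∀ {n} (P : ℕ → Set) → (∀ (i : Fin n) → P (suc (toℕ i))) →
                  ∀ {r} → 0 ℕ.< r → r ℕ.< suc n → P r
∀Fin⇒∀positive< P P-suc {suc r} _ r<1+n =
  subst (P ∘ suc) (toℕ-fromℕ< (ℕ.s<s⁻¹ r<1+n)) (P-suc (Fin.fromℕ< (ℕ.s<s⁻¹ r<1+n)))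

-- Lookup by the binary digits of the index, least significant first.  Evaluating the
-- certificates below makes about 10⁶ lookups, for which list indexing is too slow.
data BitTrie (A : Set) : Set where
  leaf : A → BitTrie A
  node : BitTrie A → BitTrie A → BitTrie A

module _ {A : Set} where

  lookup : BitTrie A → ℕ → A
  lookup (leaf x)   _ = x
  lookup (node l r) k with k ℕ.% 2
  ... | zero  = lookup l (k ℕ./ 2)
  ... | suc _ = lookup r (k ℕ./ 2)

  evens odds : List A → List A
  evens []       = []
  evens (x ∷ xs) = x ∷ odds xs
  odds  []       = []
  odds  (_ ∷ xs) = evens xs

  -- A trie of the given depth; indices beyond the end of the list hold the default.
  fromList : ℕ → A → List A → BitTrie A
  fromList zero    default []      = leaf default
  fromList zero    default (x ∷ _) = leaf x
  fromList (suc d) default xs      = node (fromList d default (evens xs)) (fromList d default (odds xs))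

signs : String → List Sign
signs str = List.map (λ c → if fromChar c == "+" then Sign.+ else Sign.-) (toList str)

sequenceStrings : Vec String 4
sequenceStrings =
  "++-+-+--+-------++----++++--+--+-++-+-+-+++-+---++-++++++++-++-+--+---+-+-+-+++-+---++++-+-+-+-+--++-++++-+-++++--+-+++++-----+-+-++-++-----+--+-++++--+-+-+++++--+--+++-++++++--+-++++-++--+++--+-----+++++-++---++--+----+-++------+---++-++-----+-+-++----+-++-+++++--+--+-+-+++++-----+-++----+-+----+--++-+-+-+-+----+++-+---+-+-+-+++-++-+--+--------+--+++-+---+-+-+--+-++-++----++++--+++++++-++-+-+-" ∷
  "+-+-+++-++++-++---+----++-------+++--+++-++-+-++--+-+---+--+--+++----+-++--+-+--+-+------+++----+++---+---++++++-++++--++++-+--++--++------+++--++-++++++-+++---++------+-+++++-+-+----+--+++++---+++++++-++--+-++-++++-+-+-++--+--++++-+++++-++-+---+-+++-++--+---+++-+-++-++++---+---++-++--+-+---+--+--+--+---+++--+++-+-+-++----++-+--+-+-++--++++++++-++-+--+++-++++++-+++++-+--+---+-+-+-++-+--+-+---++" ∷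
  "++-+-+-+-++-+--++--++----+++---+--+++----+-++++++----++++++--+----+-++++---++++-+-+-+++-++---+---++++-+-+-------++---++-++++-+++----+++---++--+++-+++--+-+++--+++-++++-+++---++--+++-++-++-+--+-+---+-----+-+++--++-++--+++-++++-++-+--+++-+--+++-+--------+-+--++++++++--++-----+-----++---+-++-+++-++-++-++-+++-+++-+++-+--+-+++++--++----++---+-++-+++-+-++-+---+++--++--+--+-+-++--++++-+--+-++-+---+++--" ∷
  "++++--++-++--+-+++---+++-+--+++++-------+----+-+++++--------+++--+++++--+++++--+-++++--++---++++++-+-+-++++-+++-+-+++--+-+++-+++-++-++-+++--+--++----+--+++-++--+-----+++-+++--+--+-+-++--+----+-+--+++--+-+++-+++-----+-+++--+-----+--+--+-++--+--++-++--+-+-+++-----+-+-++++--+++-++++-+---++---+-+-+-++----++-++--++-++-++-++---++---++++-++-+++-+----++-+---+-++-+++-++++---++++-++++-+++-+--+-+-++--+---" ∷ []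

-- Parametrised by the tries so that their evaluation is shared by all the checks.
module Certificate (tries : Vec (BitTrie Sign) 4) where

  s : Fin 4 → ℤ → ℤ
  s k = extend 397 (lookup (Vec.lookup tries k))

  fastPaf : ℕ → ℤ
  fastPaf r = ∑ (λ k → sumRange (λ u → s k (+ u) * s k (+ u + + r)) 0 397)

  paf? : Dec (∀ (i : Fin 396) → fastPaf (suc (toℕ i)) ≡ 0ℤ)
  paf? = all? (λ i → fastPaf (suc (toℕ i)) ℤ.≟ 0ℤ)

  skew? : Dec (∀ (i : Fin 396) → s 0F (+ suc (toℕ i)) + s 0F (- + suc (toℕ i)) ≡ 0ℤ)
  skew? = all? (λ i → s 0F (+ suc (toℕ i)) + s 0F (- + suc (toℕ i)) ℤ.≟ 0ℤ)

  ∑autocorrelation≡fastPaf : ∀ r → ∑ (λ k → autocorrelation 397 (s k) (+ r)) ≡ fastPaf r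
  ∑autocorrelation≡fastPaf r = ∑-cong λ k → periodSum-sumRange 397 (λ u → s k u * s k (u + + r))

  sequences : (∀ (i : Fin 396) → fastPaf (suc (toℕ i)) ≡ 0ℤ) →
              (∀ (i : Fin 396) → s 0F (+ suc (toℕ i)) + s 0F (- + suc (toℕ i)) ≡ 0ℤ) →
              s 0F 0ℤ ≡ 1ℤ → SkewGoethalsSeidelSequences 397
  sequences paf-vanishes skew s₀-origin = record
    { s            = s
    ; s-periodic   = λ k → extend-periodic 397 (lookup (Vec.lookup tries k))
    ; s-±1         = λ k → extend-±1 397 (lookup (Vec.lookup tries k))
    ; paf-vanishes = ∀Fin⇒∀positive< (λ r → ∑ (λ k → autocorrelation 397 (s k) (+ r)) ≡ 0ℤ)
                       (λ i → trans (∑autocorrelation≡fastPaf (suc (toℕ i))) (paf-vanishes i))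
    ; s₀-origin    = s₀-origin
    ; s₀-skew      = ∀Fin⇒∀positive< (λ r → s 0F (+ r) + s 0F (- + r) ≡ 0ℤ) skew
    }

-- Depth 9 as 2⁹ ≥ 397.
open Certificate (Vec.map (fromList 9 Sign.+ ∘ signs) sequenceStrings)

mainTheorem1 : ∃ λ (M : Matrix 1588) → IsSkewHadamard 1588 M
mainTheorem1 = GoethalsSeidel.skewHadamard (sequences (from-yes paf?) (from-yes skew?) refl)
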